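{- For any fixed integers $t\ge 3$ and $1\le k<t$, we have $m_t(n,k)=O(n^{\lfloor\frac{(t-2)k}{t-1}\rfloor})=O(n^{k-1})$ as $n\to\infty$.
   Context: A maximal independent set (MIS) of a graph is an independent set maximal with respect to inclusion; a $k$-MIS is an MIS of size $k$. $m_t(n,k)$ denotes the maximum number of $k$-MIS's in a $K_t$-free graph on $n$ vertices. -}

module Defs where

open import Data.Nat using (ℕ; suc; _*_; _∸_; _/_)
open import Data.Fin using (Fin)
open import Data.Fin.Subset using (Subset; _∈_; _⊆_; ∣_∣)
open import Data.Product using (_×_; Σ-syntax)
open import Relation.Nullary using (¬_)
open import Relation.Binary.PropositionalEquality using (_≡_; _≢_)

record Graph (n : ℕ) : Set₁ where
  field
    Adj   : Fin n → Fin n → Set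
    sym   : ∀ {u v} → Adj u v → Adj v u
    irrefl : ∀ {v} → ¬ Adj v v
open Graph public

ContainsK : {n : ℕ} → ℕ → Graph n → Set
ContainsK {n} t G =
  Σ[ f ∈ (Fin t → Fin n) ] (∀ i j → i ≢ j → Adj G (f i) (f j))

KFree : {n : ℕ} → ℕ → Graph n → Set
KFree t G = ¬ ContainsK t G

Independent : {n : ℕ} → Graph n → Subset n → Set
Independent G S = ∀ u v → u ∈ S → v ∈ S → ¬ Adj G u v

IsMIS : {n : ℕ} → Graph n → Subset n → Set
IsMIS G S = Independent G S × (∀ T → Independent G T → S ⊆ T → T ≡ S)

IsKMIS : {n : ℕ} → Graph n → ℕ → Subset n → Set
IsKMIS G k S = IsMIS G S × ∣ S ∣ ≡ k

-- ⌊ (t-2)k / (t-1) ⌋ ; for t ≥ 2 we have t - 1 = suc (t - 2),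
-- written this way so the divisor is syntactically nonzero.
expo : ℕ → ℕ → ℕ
expo t k = ((t ∸ 2) * k) / suc (t ∸ 2)

-- Remove from every k-MIS S its least vertex s, leaving a (k-1)-set R.  Two k-MIS's
-- R ∪ {s} and R ∪ {s′} with the same R have adjacent apexes s, s′: otherwise
-- R ∪ {s, s′} would be an independent set strictly containing the first one.  Hence the
-- apexes of each fibre form a clique, so a K_t-free graph has fewer than t k-MIS's over
-- each of the at most n^(k-1) sets R.  For 1 ≤ k < t the exponent ⌊(t-2)k/(t-1)⌋ is k - 1.
module Submission where

open import Defs
open import Data.Nat using (ℕ; zero; suc; _+_; _*_; _^_; _∸_; _/_; _≤_; _<_; z≤n; s≤s)
open import Data.Nat.Properties
open import Data.Nat.DivMod using (+-distrib-/-∣ʳ; m<n⇒m/n≡0; m*n/n≡m)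
open import Data.Nat.Divisibility using (divides-refl)
open import Data.Bool using (true; false)
open import Data.Bool.Properties using () renaming (_≟_ to _≟ᵇ_)
open import Data.Vec using ([]; _∷_)
open import Data.Vec.Properties using () renaming (≡-dec to ≡-decᵛ)
open import Data.Fin using (Fin; zero; suc; inject≤) renaming (_≟_ to _≟ᶠ_)
open import Data.Fin.Properties using (inject≤-injective)
open import Data.Fin.Subset using (Subset; _∉_; _∪_; ⁅_⁆; ∣_∣) renaming (_∈_ to _∈ˢ_)
open import Data.Fin.Subset.Properties using (x∈p∪q⁻; x∈p∪q⁺; p⊆p∪q; x∈⁅x⁆; x∈⁅y⁆⇒x≡y; ∪-identityʳ; drop-there)
open import Data.Maybe using (Maybe; just; nothing; fromMaybe)
import Data.Maybe as Maybe
open import Data.List using (List; []; _∷_; length; lookup; filter; map; _++_)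
open import Data.List.Properties using (length-map; length-++)
open import Data.List.Relation.Unary.All as All using (All; _∷_)
import Data.List.Relation.Unary.All.Properties as All
open import Data.List.Relation.Unary.AllPairs using (_∷_)
open import Data.List.Relation.Unary.Unique.Propositional using (Unique)
import Data.List.Relation.Unary.Unique.Propositional.Properties as Unique
open import Data.List.Membership.Propositional using (_∈_)
open import Data.List.Membership.Propositional.Properties using (∈-lookup; ∈-map⁺; ∈-++⁺ˡ; ∈-++⁺ʳ)
open import Data.List.Relation.Unary.Any using (here; there)
open import Data.Product using (_×_; _,_; proj₂; ∃-syntax)
open import Data.Sum using (_⊎_; inj₁; inj₂)
open import Data.Empty using (⊥-elim)
open import Function using (_∘_)
open import Relation.Nullary using (¬_; yes; no)
open import Relation.Nullary.Decidable using (decidable-stable)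
open import Relation.Unary using (Decidable)
open import Relation.Unary.Properties using (∁?)
open import Relation.Binary using (DecidableEquality)
open import Relation.Binary.PropositionalEquality
  using (_≡_; _≢_; refl; cong; cong₂; subst; module ≡-Reasoning) renaming (sym to ≡-sym; trans to ≡-trans)

private
  variable
    A B : Set
    n j : ℕ

¬¬-∀-Fin : {P : Fin n → Set} → (∀ i → ¬ ¬ P i) → ¬ ¬ (∀ i → P i)
¬¬-∀-Fin {zero}      _  k = k (λ ())
¬¬-∀-Fin {suc n} {P} nn k =
  nn zero λ p₀ → ¬¬-∀-Fin {P = λ i → P (suc i)} (λ i → nn (suc i)) λ ps →
    k λ { zero → p₀ ; (suc i) → ps i }

lookup-injective : {xs : List A} → Unique xs → ∀ i j → lookup xs i ≡ lookup xs j → i ≡ j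
lookup-injective (_  ∷ _) zero    zero    _ = refl
lookup-injective (x≢ ∷ _) zero    (suc j) e = ⊥-elim (All.lookup x≢ (∈-lookup j) e)
lookup-injective (x≢ ∷ _) (suc i) zero    e = ⊥-elim (All.lookup x≢ (∈-lookup i) (≡-sym e))
lookup-injective (_  ∷ u) (suc i) (suc j) e = cong suc (lookup-injective u i j e)

length≡filter+∁filter : {P : A → Set} (P? : Decidable P) (xs : List A) →
  length xs ≡ length (filter P? xs) + length (filter (∁? P?) xs)
length≡filter+∁filter P? []       = refl
length≡filter+∁filter P? (x ∷ xs) with P? x
... | yes _ = cong suc (length≡filter+∁filter P? xs)
... | no  _ = ≡-trans (cong suc (length≡filter+∁filter P? xs)) (≡-sym (+-suc _ _))

length≤fibreBound*length : (_≟_ : DecidableEquality B) (P : A → Set) (f : A → B) (m : ℕ) →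
  (∀ b ys → Unique ys → All (λ y → P y × f y ≡ b) ys → length ys ≤ m) →
  (bs : List B) (xs : List A) → Unique xs → All (λ x → P x × f x ∈ bs) xs →
  length xs ≤ m * length bs
length≤fibreBound*length _≟_ P f m fibre [] [] _ _ = z≤n
length≤fibreBound*length _≟_ P f m fibre [] (_ ∷ _) _ ((_ , ()) ∷ _)
length≤fibreBound*length _≟_ P f m fibre (b ∷ bs) xs u pxs = begin
  length xs                                              ≡⟨ length≡filter+∁filter over? xs ⟩
  length (filter over? xs) + length (filter (∁? over?) xs) ≤⟨ +-mono-≤ inFibre rest ⟩
  m + m * length bs                                      ≡⟨ *-suc m (length bs) ⟨
  m * suc (length bs)                                    ∎
  where
  open ≤-Reasoning
  over? : Decidable (λ x → f x ≡ b)
  over? x = f x ≟ b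
  inFibre : length (filter over? xs) ≤ m
  inFibre = fibre b _ (Unique.filter⁺ over? u)
    (All.zipWith (λ { ((p , _) , e) → p , e }) (All.filter⁺ over? pxs , All.all-filter over? xs))
  rest : length (filter (∁? over?) xs) ≤ m * length bs
  rest = length≤fibreBound*length _≟_ P f m fibre bs _ (Unique.filter⁺ (∁? over?) u)
    (All.zipWith (λ { ((p , here e) , ≢b) → ⊥-elim (≢b e) ; ((p , there fx∈) , _) → p , fx∈ })
      (All.filter⁺ (∁? over?) pxs , All.all-filter (∁? over?) xs))

subsetsOfSize : (n k : ℕ) → List (Subset n)
subsetsOfSize zero    zero    = [] ∷ []
subsetsOfSize zero    (suc k) = []
subsetsOfSize (suc n) zero    = map (false ∷_) (subsetsOfSize n zero)
subsetsOfSize (suc n) (suc k) =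
  map (true ∷_) (subsetsOfSize n k) ++ map (false ∷_) (subsetsOfSize n (suc k))

∈-subsetsOfSize : ∀ (p : Subset n) k → ∣ p ∣ ≡ k → p ∈ subsetsOfSize n k
∈-subsetsOfSize []          zero    _ = here refl
∈-subsetsOfSize (true ∷ p)  (suc k) e = ∈-++⁺ˡ (∈-map⁺ (true ∷_) (∈-subsetsOfSize p k (suc-injective e)))
∈-subsetsOfSize (false ∷ p) zero    e = ∈-map⁺ (false ∷_) (∈-subsetsOfSize p zero e)
∈-subsetsOfSize (false ∷ p) (suc k) e =
  ∈-++⁺ʳ (map (true ∷_) (subsetsOfSize _ k)) (∈-map⁺ (false ∷_) (∈-subsetsOfSize p (suc k) e))

length-subsetsOfSize≤ : ∀ n k → length (subsetsOfSize n k) ≤ n ^ k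
length-subsetsOfSize≤ zero    zero    = ≤-refl
length-subsetsOfSize≤ zero    (suc k) = z≤n
length-subsetsOfSize≤ (suc n) zero    =
  ≤-trans (≤-reflexive (length-map _ (subsetsOfSize n zero))) (length-subsetsOfSize≤ n zero)
length-subsetsOfSize≤ (suc n) (suc k) = begin
  length (map (true ∷_) (subsetsOfSize n k) ++ map (false ∷_) (subsetsOfSize n (suc k)))
    ≡⟨ length-++ (map (true ∷_) (subsetsOfSize n k)) ⟩
  length (map (true ∷_) (subsetsOfSize n k)) + length (map (false ∷_) (subsetsOfSize n (suc k)))
    ≡⟨ cong₂ _+_ (length-map _ (subsetsOfSize n k)) (length-map _ (subsetsOfSize n (suc k))) ⟩
  length (subsetsOfSize n k) + length (subsetsOfSize n (suc k))
    ≤⟨ +-mono-≤ (length-subsetsOfSize≤ n k) (length-subsetsOfSize≤ n (suc k)) ⟩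
  suc n * n ^ k
    ≤⟨ *-monoʳ-≤ (suc n) (^-monoˡ-≤ k (n≤1+n n)) ⟩
  suc n * suc n ^ k
    ∎
  where open ≤-Reasoning

least : Subset n → Maybe (Fin n)
least []          = nothing
least (true ∷ _)  = just zero
least (false ∷ p) = Maybe.map suc (least p)

dropLeast : Subset n → Subset n
dropLeast []          = []
dropLeast (true ∷ p)  = false ∷ p
dropLeast (false ∷ p) = false ∷ dropLeast p

least∉dropLeast : ∀ (p : Subset n) {x} → least p ≡ just x → x ∉ dropLeast p
least∉dropLeast (true ∷ p)  refl ()
least∉dropLeast (false ∷ p) eq   with least p in e
least∉dropLeast (false ∷ p) refl | just x = least∉dropLeast p e ∘ drop-there

dropLeast∪least≡ : ∀ (p : Subset n) {x} → least p ≡ just x → dropLeast p ∪ ⁅ x ⁆ ≡ p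
dropLeast∪least≡ (true ∷ p)  refl = cong (true ∷_) (∪-identityʳ p)
dropLeast∪least≡ (false ∷ p) eq   with least p in e
dropLeast∪least≡ (false ∷ p) refl | just x = cong (false ∷_) (dropLeast∪least≡ p e)

least-size : ∀ (p : Subset n) → ∣ p ∣ ≡ suc j → (∃[ x ] least p ≡ just x) × ∣ dropLeast p ∣ ≡ j
least-size (true ∷ p)  refl = (zero , refl) , refl
least-size (false ∷ p) e with least-size p e
... | (x , eq) , size = (suc x , cong (Maybe.map suc) eq) , size

∉-other-extension : ∀ {R : Subset n} {s t} → t ∉ R → R ∪ ⁅ s ⁆ ≢ R ∪ ⁅ t ⁆ → t ∉ R ∪ ⁅ s ⁆
∉-other-extension {R = R} {s} t∉R ≢ t∈ with x∈p∪q⁻ R ⁅ s ⁆ t∈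
... | inj₁ t∈R = t∉R t∈R
... | inj₂ t∈s rewrite x∈⁅y⁆⇒x≡y s t∈s = ≢ refl

module _ {n} (G : Graph n) where

  MIS-dominating : ∀ {S y} → IsMIS G S → y ∉ S → ¬ (∀ w → w ∈ˢ S → ¬ Adj G y w)
  MIS-dominating {S} {y} (indS , maxS) y∉S y-free = y∉S (subst (y ∈ˢ_) S+y≡S y∈S+y)
    where
    y∈S+y : y ∈ˢ S ∪ ⁅ y ⁆
    y∈S+y = x∈p∪q⁺ (inj₂ (x∈⁅x⁆ y))
    cases : ∀ {u} → u ∈ˢ S ∪ ⁅ y ⁆ → u ∈ˢ S ⊎ u ≡ y
    cases {u} u∈ with x∈p∪q⁻ S ⁅ y ⁆ u∈
    ... | inj₁ u∈S = inj₁ u∈S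
    ... | inj₂ u∈y = inj₂ (x∈⁅y⁆⇒x≡y y u∈y)
    indS+y : Independent G (S ∪ ⁅ y ⁆)
    indS+y u w u∈ w∈ with cases u∈ | cases w∈
    ... | inj₁ u∈S | inj₁ w∈S = indS u w u∈S w∈S
    ... | inj₂ refl | inj₁ w∈S = y-free w w∈S
    ... | inj₁ u∈S | inj₂ refl = λ a → y-free u u∈S (Graph.sym G a)
    ... | inj₂ refl | inj₂ refl = Graph.irrefl G
    S+y≡S : S ∪ ⁅ y ⁆ ≡ S
    S+y≡S = maxS (S ∪ ⁅ y ⁆) indS+y (p⊆p∪q ⁅ y ⁆)

  one-point-extensions-adjacent : ∀ {R s t} → IsMIS G (R ∪ ⁅ s ⁆) → Independent G (R ∪ ⁅ t ⁆) →
    t ∉ R ∪ ⁅ s ⁆ → ¬ ¬ Adj G s t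
  one-point-extensions-adjacent {R} {s} {t} mis ind t∉ ¬adj = MIS-dominating mis t∉ t-free
    where
    t-free : ∀ w → w ∈ˢ R ∪ ⁅ s ⁆ → ¬ Adj G t w
    t-free w w∈ with x∈p∪q⁻ R ⁅ s ⁆ w∈
    ... | inj₁ w∈R = ind t w (x∈p∪q⁺ (inj₂ (x∈⁅x⁆ t))) (p⊆p∪q ⁅ t ⁆ w∈R)
    ... | inj₂ w∈s rewrite x∈⁅y⁆⇒x≡y s w∈s = λ a → ¬adj (Graph.sym G a)

  ¬¬Clique : (A → Fin n) → List A → Set
  ¬¬Clique v xs = ∀ x y → x ∈ xs → y ∈ xs → x ≢ y → ¬ ¬ Adj G (v x) (v y)

  ¬¬Clique⇒¬¬ContainsK : ∀ {A : Set} {t} (v : A → Fin n) {xs : List A} →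
    Unique xs → ¬¬Clique v xs → t ≤ length xs → ¬ ¬ ContainsK t G
  ¬¬Clique⇒¬¬ContainsK {A} {t} v {xs} u clique t≤ ¬K =
    ¬¬-∀-Fin (λ i → ¬¬-∀-Fin (pair i)) (λ adj → ¬K ((λ i → v (pick i)) , adj))
    where
    pick : Fin t → A
    pick i = lookup xs (inject≤ i t≤)
    pair : ∀ i j → ¬ ¬ (i ≢ j → Adj G (v (pick i)) (v (pick j)))
    pair i j k with i ≟ᶠ j
    ... | yes i≡j = k (λ i≢j → ⊥-elim (i≢j i≡j))
    ... | no  i≢j = clique _ _ (∈-lookup _) (∈-lookup _)
            (λ e → i≢j (inject≤-injective t≤ t≤ i j (lookup-injective u _ _ e)))
            (λ a → k (λ _ → a))

  KFree⇒¬¬Clique-length< : ∀ t → KFree t G → (v : A → Fin n) (xs : List A) →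
    Unique xs → ¬¬Clique v xs → length xs < t
  KFree⇒¬¬Clique-length< t kf v xs u clique =
    decidable-stable (length xs <? t) λ ≮t → ¬¬Clique⇒¬¬ContainsK v u clique (≮⇒≥ ≮t) kf

module _ {n} (G : Graph (suc n)) where

  -- zero is a junk value: apex is only applied to nonempty sets.
  apex : Subset (suc n) → Fin (suc n)
  apex S = fromMaybe zero (least S)

  apex-split : ∀ {R} S → ∣ S ∣ ≡ suc j → dropLeast S ≡ R → S ≡ R ∪ ⁅ apex S ⁆ × apex S ∉ R
  apex-split S ∣S∣ refl with least-size S ∣S∣
  ... | (x , eq) , _ rewrite eq = ≡-sym (dropLeast∪least≡ S eq) , least∉dropLeast S eq

  fibre-¬¬Clique : ∀ R (xs : List (Subset (suc n))) →
    All (λ S → IsKMIS G (suc j) S × dropLeast S ≡ R) xs → ¬¬Clique G apex xs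
  fibre-¬¬Clique R xs fibre S T S∈ T∈ S≢T
    with All.lookup fibre S∈ | All.lookup fibre T∈
  ... | (misS , ∣S∣) , RS | ((indT , _) , ∣T∣) , RT
    with apex-split S ∣S∣ RS | apex-split T ∣T∣ RT
  ... | S≡ , _ | T≡ , sT∉R =
    one-point-extensions-adjacent G (subst (IsMIS G) S≡ misS) (subst (Independent G) T≡ indT)
      (∉-other-extension sT∉R λ e → S≢T (≡-trans S≡ (≡-trans e (≡-sym T≡))))

  kMIS-count : ∀ t → KFree t G → (L : List (Subset (suc n))) → Unique L →
    All (IsKMIS G (suc j)) L → length L ≤ (t ∸ 1) * suc n ^ j
  kMIS-count {j} t kf L u kmis = begin
    length L                                    ≤⟨ countByFibres ⟩
    (t ∸ 1) * length (subsetsOfSize (suc n) j)  ≤⟨ *-monoʳ-≤ (t ∸ 1) (length-subsetsOfSize≤ (suc n) j) ⟩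
    (t ∸ 1) * suc n ^ j                         ∎
    where
    open ≤-Reasoning
    fibreBound : ∀ R xs → Unique xs → All (λ S → IsKMIS G (suc j) S × dropLeast S ≡ R) xs →
      length xs ≤ t ∸ 1
    fibreBound R xs uxs fibre =
      <⇒≤pred (KFree⇒¬¬Clique-length< G t kf apex xs uxs (fibre-¬¬Clique R xs fibre))
    countByFibres : length L ≤ (t ∸ 1) * length (subsetsOfSize (suc n) j)
    countByFibres = length≤fibreBound*length (≡-decᵛ _≟ᵇ_) (IsKMIS G (suc j)) dropLeast (t ∸ 1)
      fibreBound (subsetsOfSize (suc n) j) L u
      (All.map (λ {S} k → k , ∈-subsetsOfSize (dropLeast S) j (proj₂ (least-size S (proj₂ k)))) kmis)

m*[1+n]/[1+m]≡n : ∀ m n → n ≤ m → m * suc n / suc m ≡ n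
m*[1+n]/[1+m]≡n m n n≤m = begin
  m * suc n / suc m                     ≡⟨ cong (_/ suc m) split ⟩
  ((m ∸ n) + n * suc m) / suc m         ≡⟨ +-distrib-/-∣ʳ (m ∸ n) (divides-refl n) ⟩
  (m ∸ n) / suc m + n * suc m / suc m   ≡⟨ cong₂ _+_ (m<n⇒m/n≡0 (s≤s (m∸n≤m m n))) (m*n/n≡m n (suc m)) ⟩
  n                                     ∎
  where
  open ≡-Reasoning
  split : m * suc n ≡ (m ∸ n) + n * suc m
  split = begin
    m * suc n              ≡⟨ *-suc m n ⟩
    m + m * n              ≡⟨ cong (_+ m * n) (m∸n+n≡m n≤m) ⟨
    (m ∸ n) + n + m * n    ≡⟨ +-assoc (m ∸ n) n (m * n) ⟩
    (m ∸ n) + (n + m * n)  ≡⟨ cong (λ z → (m ∸ n) + (n + z)) (*-comm m n) ⟩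
    (m ∸ n) + (n + n * m)  ≡⟨ cong ((m ∸ n) +_) (*-suc n m) ⟨
    (m ∸ n) + n * suc m    ∎

expo-suc : ∀ t k → suc k < t → expo t (suc k) ≡ k
expo-suc (suc (suc t)) k (s≤s (s≤s k≤t)) = m*[1+n]/[1+m]≡n t k k≤t

proposition1p5 : (t k : ℕ) → 3 ≤ t → 1 ≤ k → k < t →
    ∃[ C ] ∃[ N ] ((n : ℕ) → N ≤ n → (G : Graph n) → KFree t G →
      (L : List (Subset n)) → Unique L → All (IsKMIS G k) L →
      (length L ≤ C * n ^ expo t k) × (length L ≤ C * n ^ (k ∸ 1)))
proposition1p5 t (suc j) _ _ k<t = t ∸ 1 , 1 , bounds
  where
  bounds : (n : ℕ) → 1 ≤ n → (G : Graph n) → KFree t G →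
    (L : List (Subset n)) → Unique L → All (IsKMIS G (suc j)) L →
    (length L ≤ (t ∸ 1) * n ^ expo t (suc j)) × (length L ≤ (t ∸ 1) * n ^ j)
  bounds (suc n) _ G kf L u kmis =
    subst (λ e → length L ≤ (t ∸ 1) * suc n ^ e) (≡-sym (expo-suc t j k<t)) count , count
    where
    count : length L ≤ (t ∸ 1) * suc n ^ j
    count = kMIS-count G t kf L u kmis
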